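{- Let $f:\subseteq\mathbb{N}^\mathbb{N}\rightrightarrows\mathbb{N}^\mathbb{N}$ be a problem and $P\in\{\mathrm I,\mathrm{II}\}$. Then Player $P$ has a winning strategy for the Wadge game $f$ if and only if Player $P$ has a winning strategy for the Lipschitz game $f^{\mathrm w}$.
   Context: Let $\mathrm w:\mathbb{N}\to\mathbb{N}^*$, $i\mapsto\mathrm w_i$, be a canonical bijective numbering of finite words over $\mathbb{N}$, lifted to the partial map $\mathrm w:\subseteq\mathbb{N}^\mathbb{N}\to\mathbb{N}^\mathbb{N}$, $p\mapsto\mathrm w_{p(0)}\mathrm w_{p(1)}\mathrm w_{p(2)}\dots$, with domain those $p$ for which this concatenation is infinite. $f^{\mathrm w}:=\mathrm w^{ -1}\circ f\circ\mathrm w$. Wadge game of $g:\subseteq\mathbb{N}^\mathbb{N}\rightrightarrows\mathbb{N}^\mathbb{N}$: Players I and II alternately play finite words $x_0,y_0,x_1,y_1,\dots\in\mathbb{N}^*$ (I starts); with $x=x_0x_1\dots$, $y=y_0y_1\dots$ (finite or infinite), II wins if $(x,y)\in\mathrm{graph}(g)$ or $x\notin\mathrm{dom}(g)$, otherwise I wins; strategies are functions $\sigma:(\mathbb{N}^*)^*\to\mathbb{N}^*$ (II: $y_i=\sigma(x_0,\dots,x_i)$; I: $x_i=\sigma(y_0,\dots,y_{i-1})$), winning if the corresponding player wins every run played according to it. The Lipschitz game is the same with moves $x_i,y_i\in\mathbb{N}$ and strategies $\sigma:\mathbb{N}^*\to\mathbb{N}$. -}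

module Defs where

open import Data.Nat using (ℕ; suc; _≤_)
open import Data.List using (List; concat; length; applyUpTo)
open import Data.Product using (Σ; Σ-syntax; _×_)
open import Data.Sum using (_⊎_)
open import Relation.Nullary using (¬_)
open import Relation.Binary.PropositionalEquality using (_≡_)
open import Function using (_∘_)

Baire : Set
Baire = ℕ → ℕ

Problem : Set₁
Problem = Baire → Baire → Set

Dom : Problem → Baire → Set
Dom R x = Σ[ y ∈ Baire ] R x y

Word : Set
Word = List ℕ

flat : (ℕ → Word) → ℕ → Word
flat ws n = concat (applyUpTo ws n)

-- The (possibly finite) concatenation ws 0 ws 1 ws 2 … is infinite and equals p.
Concat : (ℕ → Word) → Baire → Set
Concat ws p =
  (∀ n → flat ws n ≡ applyUpTo p (length (flat ws n))) ×
  (∀ m → Σ[ n ∈ ℕ ] m ≤ length (flat ws n))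

-- f^w = w⁻¹ ∘ f ∘ w, for a numbering w : ℕ → ℕ* of words, where
-- w(p) = w_{p(0)} w_{p(1)} … (defined iff this concatenation is infinite).
liftW : (ℕ → Word) → Problem → Problem
liftW w R p q = Σ[ x ∈ Baire ] Σ[ y ∈ Baire ]
  (Concat (w ∘ p) x × Concat (w ∘ q) y × R x y)

data Player : Set where
  I II : Player

WadgeIIWinsRun : Problem → (ℕ → Word) → (ℕ → Word) → Set
WadgeIIWinsRun R xs ys =
  (Σ[ p ∈ Baire ] Σ[ q ∈ Baire ] (Concat xs p × Concat ys q × R p q))
  ⊎ ¬ (Σ[ p ∈ Baire ] (Concat xs p × Dom R p))

WadgeStrategy : Set
WadgeStrategy = List Word → Word

WadgeWin : Player → Problem → Set
WadgeWin II R = Σ[ σ ∈ WadgeStrategy ]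
  (∀ (xs : ℕ → Word) → WadgeIIWinsRun R xs (λ i → σ (applyUpTo xs (suc i))))
WadgeWin I R = Σ[ σ ∈ WadgeStrategy ]
  (∀ (ys : ℕ → Word) → ¬ WadgeIIWinsRun R (λ i → σ (applyUpTo ys i)) ys)

LipschitzIIWinsRun : Problem → Baire → Baire → Set
LipschitzIIWinsRun R x y = R x y ⊎ ¬ Dom R x

LipschitzStrategy : Set
LipschitzStrategy = List ℕ → ℕ

LipschitzWin : Player → Problem → Set
LipschitzWin II R = Σ[ σ ∈ LipschitzStrategy ]
  (∀ (x : Baire) → LipschitzIIWinsRun R x (λ i → σ (applyUpTo x (suc i))))
LipschitzWin I R = Σ[ σ ∈ LipschitzStrategy ]
  (∀ (y : Baire) → ¬ LipschitzIIWinsRun R (λ i → σ (applyUpTo y i)) y)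

-- A run of either game determines a run of the other: a Lipschitz move n stands for the
-- Wadge move w n, and a Wadge move u for any name of it, e.g. the one chosen by a
-- section w⁻ of the surjection w. Under this dictionary the first disjunct of "II wins"
-- is literally the same in both games, and the domains agree because every q ∈ dom R is
-- the concatenation of the one-letter words [ q i ], each of which has a name.
module Submission where

open import Defs
open import Data.Nat using (ℕ; zero; suc; _≤_)
open import Data.Nat.Properties using (≤-reflexive)
open import Data.List using (_∷_; [_]; map; concat; length; applyUpTo)
open import Data.List.Properties using (length-applyUpTo; map-applyUpTo)
open import Data.Product using (_,_; proj₁; proj₂)
open import Data.Sum using (inj₁; inj₂)
open import Function using (_∘_; id; _⇔_; mk⇔; Equivalence)
open import Function.Definitions using (Bijective)
open import Relation.Binary.PropositionalEquality
  using (_≡_; _≗_; refl; sym; trans; cong; cong₂; subst; module ≡-Reasoning)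

open Equivalence using (to; from)

applyUpTo-cong : {A : Set} {f g : ℕ → A} → f ≗ g → applyUpTo f ≗ applyUpTo g
applyUpTo-cong f≗g zero    = refl
applyUpTo-cong f≗g (suc n) = cong₂ _∷_ (f≗g 0) (applyUpTo-cong (f≗g ∘ suc) n)

Concat-resp-≗ : {ws ws′ : ℕ → Word} {p : Baire} → ws ≗ ws′ → Concat ws p → Concat ws′ p
Concat-resp-≗ {ws} {ws′} {p} ws≗ws′ (prefix , unbounded) =
  (λ n → subst (λ u → u ≡ applyUpTo p (length u)) (flat-≗ n) (prefix n)) ,
  (λ m → let n , m≤ = unbounded m in n , subst (λ u → m ≤ length u) (flat-≗ n) m≤)
  where
  flat-≗ : flat ws ≗ flat ws′
  flat-≗ = cong concat ∘ applyUpTo-cong ws≗ws′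

flat-singletons : (q : Baire) → flat ([_] ∘ q) ≗ applyUpTo q
flat-singletons q zero    = refl
flat-singletons q (suc n) = cong (q 0 ∷_) (flat-singletons (q ∘ suc) n)

Concat-singletons : (q : Baire) → Concat ([_] ∘ q) q
Concat-singletons q = prefix , λ m → m , ≤-reflexive (sym (length-flat m))
  where
  length-flat : ∀ n → length (flat ([_] ∘ q) n) ≡ n
  length-flat n = trans (cong length (flat-singletons q n)) (length-applyUpTo q n)

  open ≡-Reasoning
  prefix : ∀ n → flat ([_] ∘ q) n ≡ applyUpTo q (length (flat ([_] ∘ q) n))
  prefix n = begin
    flat ([_] ∘ q) n                          ≡⟨ flat-singletons q n ⟩
    applyUpTo q n                             ≡⟨ cong (applyUpTo q) (sym (length-flat n)) ⟩
    applyUpTo q (length (flat ([_] ∘ q) n))   ∎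

WadgeIIWinsRun-resp-≗ : {R : Problem} {xs xs′ ys ys′ : ℕ → Word} → xs ≗ xs′ → ys ≗ ys′ →
  WadgeIIWinsRun R xs ys → WadgeIIWinsRun R xs′ ys′
WadgeIIWinsRun-resp-≗ xs≗xs′ ys≗ys′ (inj₁ (p , q , xs↦p , ys↦q , Rpq)) =
  inj₁ (p , q , Concat-resp-≗ xs≗xs′ xs↦p , Concat-resp-≗ ys≗ys′ ys↦q , Rpq)
WadgeIIWinsRun-resp-≗ xs≗xs′ ys≗ys′ (inj₂ ∉dom) =
  inj₂ λ (p , xs′↦p , p∈dom) → ∉dom (p , Concat-resp-≗ (sym ∘ xs≗xs′) xs′↦p , p∈dom)

module _ (w : ℕ → Word) (w⁻ : Word → ℕ) (w∘w⁻≗id : w ∘ w⁻ ≗ id) where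

  Dom-liftW : {R : Problem} {x p : Baire} → Concat (w ∘ x) p → Dom R p → Dom (liftW w R) x
  Dom-liftW x↦p (q , Rpq) =
    w⁻ ∘ [_] ∘ q , _ , q , x↦p , Concat-resp-≗ (sym ∘ w∘w⁻≗id ∘ [_] ∘ q) (Concat-singletons q) , Rpq

  WadgeIIWinsRun⇔LipschitzIIWinsRun : {R : Problem} (x y : Baire) →
    WadgeIIWinsRun R (w ∘ x) (w ∘ y) ⇔ LipschitzIIWinsRun (liftW w R) x y
  WadgeIIWinsRun⇔LipschitzIIWinsRun x y = mk⇔
    (λ { (inj₁ graph) → inj₁ graph
       ; (inj₂ ∉dom)  → inj₂ λ (_ , p , _ , x↦p , _ , Rpq) → ∉dom (p , x↦p , _ , Rpq) })
    (λ { (inj₁ graph) → inj₁ graph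
       ; (inj₂ ∉dom)  → inj₂ λ (p , x↦p , p∈dom) → ∉dom (Dom-liftW x↦p p∈dom) })

  toLipschitz : WadgeStrategy → LipschitzStrategy
  toLipschitz σ = w⁻ ∘ σ ∘ map w

  toWadge : LipschitzStrategy → WadgeStrategy
  toWadge τ = w ∘ τ ∘ map w⁻

  w-toLipschitz : (σ : WadgeStrategy) (x : Baire) (n : ℕ) →
    w (toLipschitz σ (applyUpTo x n)) ≡ σ (applyUpTo (w ∘ x) n)
  w-toLipschitz σ x n = trans (w∘w⁻≗id _) (cong σ (map-applyUpTo x w n))

  toWadge-applyUpTo : (τ : LipschitzStrategy) (xs : ℕ → Word) (n : ℕ) →
    toWadge τ (applyUpTo xs n) ≡ w (τ (applyUpTo (w⁻ ∘ xs) n))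
  toWadge-applyUpTo τ xs n = cong (w ∘ τ) (map-applyUpTo xs w⁻ n)

  wadgeWin⇒lipschitzWin : (P : Player) {R : Problem} → WadgeWin P R → LipschitzWin P (liftW w R)
  wadgeWin⇒lipschitzWin II (σ , win) = toLipschitz σ , λ x →
    to (WadgeIIWinsRun⇔LipschitzIIWinsRun x _)
       (WadgeIIWinsRun-resp-≗ (λ _ → refl) (sym ∘ w-toLipschitz σ x ∘ suc) (win (w ∘ x)))
  wadgeWin⇒lipschitzWin I (σ , win) = toLipschitz σ , λ y →
    win (w ∘ y) ∘ WadgeIIWinsRun-resp-≗ (w-toLipschitz σ y) (λ _ → refl)
                ∘ from (WadgeIIWinsRun⇔LipschitzIIWinsRun _ y)

  lipschitzWin⇒wadgeWin : (P : Player) {R : Problem} → LipschitzWin P (liftW w R) → WadgeWin P R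
  lipschitzWin⇒wadgeWin II (τ , win) = toWadge τ , λ xs →
    WadgeIIWinsRun-resp-≗ (w∘w⁻≗id ∘ xs) (sym ∘ toWadge-applyUpTo τ xs ∘ suc)
      (from (WadgeIIWinsRun⇔LipschitzIIWinsRun (w⁻ ∘ xs) _) (win (w⁻ ∘ xs)))
  lipschitzWin⇒wadgeWin I (τ , win) = toWadge τ , λ ys →
    win (w⁻ ∘ ys) ∘ to (WadgeIIWinsRun⇔LipschitzIIWinsRun _ (w⁻ ∘ ys))
                  ∘ WadgeIIWinsRun-resp-≗ (toWadge-applyUpTo τ ys) (sym ∘ w∘w⁻≗id ∘ ys)

proposition32 : (w : ℕ → Word) → Bijective _≡_ _≡_ w →
    (R : Problem) (P : Player) → WadgeWin P R ⇔ LipschitzWin P (liftW w R)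
proposition32 w (_ , surjective) R P =
  mk⇔ (wadgeWin⇒lipschitzWin w w⁻ w∘w⁻≗id P) (lipschitzWin⇒wadgeWin w w⁻ w∘w⁻≗id P)
  where
  w⁻ : Word → ℕ
  w⁻ u = proj₁ (surjective u)

  w∘w⁻≗id : w ∘ w⁻ ≗ id
  w∘w⁻≗id u = proj₂ (surjective u) refl
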